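{- Let $S,S'$ be constraint systems generated by the optimised algorithm from a constraint system of the form $\{x_0\models\phi\}$. (1) If $S'$ is obtained from $S$ by an application of the $\wedge$-rule, then $S$ is satisfiable iff $S'$ is satisfiable. (2) If $S'$ is obtained from $S$ by an application of the $\vee$-rule or the $\ge$-rule, then $S$ is satisfiable if $S'$ is satisfiable; moreover, if $S$ is satisfiable, then the rule can always be applied in such a way that the resulting $S'$ is satisfiable.
   Context: Formulae in NNF: $p$, $\neg p$, $\psi_1\wedge\psi_2$, $\psi_1\vee\psi_2$, $\langle R\rangle_{\ge n}\psi$, $\langle R\rangle_{\le n}\psi$, with $\mathfrak{M},x\models\langle R\rangle_{\ge n}\psi$ (resp. $\langle R\rangle_{\le n}\psi$) iff at least (resp. at most) $n$ $R^\mathfrak{M}$-successors of $x$ satisfy $\psi$. $\sim\psi$ is the NNF of $\neg\psi$ (De Morgan, $\neg\langle R\rangle_{\ge 0}\psi\equiv p\wedge\neg p$, $\neg\langle R\rangle_{\ge n}\psi\equiv\langle R\rangle_{\le n-1}\psi$ for $n\ge1$, $\neg\langle R\rangle_{\le n}\psi\equiv\langle R\rangle_{\ge n+1}\psi$). A constraint system (c.s.) is a finite set of expressions $x\models\psi$ and $Rxy$ over variables; $\sharp R^S(x,\psi)=|\{y:\{Rxy,y\models\psi\}\subseteq S\}|$. Rules of the optimised algorithm: ($\wedge$) if $x\models\psi_1\wedge\psi_2\in S$ and not both $x\models\psi_1,x\models\psi_2\in S$, add both; ($\vee$) if $x\models\psi_1\vee\psi_2\in S$ and neither disjunct constraint is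 in $S$, add $x\models\chi$ for a chosen $\chi\in\{\psi_1,\psi_2\}$; ($\ge$) if $x\models\langle R\rangle_{\ge n}\psi\in S$, $\sharp R^S(x,\psi)<n$, and neither the $\wedge$- nor $\vee$-rule applies to a constraint for $x$, add $Rxy$, $y\models\psi$, $y\models\chi_1,\dots,y\models\chi_k$ for a fresh variable $y$, where $\{\psi_1,\dots,\psi_k\}=\{\psi':x\models\langle R\rangle_{\bowtie m}\psi'\in S,\ \bowtie\in\{\le,\ge\}\}$ and each $\chi_i\in\{\psi_i,\sim\psi_i\}$ is chosen nondeterministically. A c.s. $S$ is satisfiable iff there are a Kripke structure $\mathfrak{M}$ and a map $\alpha$ from variables to worlds such that: distinct $y,z$ with $Rxy,Rxz\in S$ have $\alpha(y)\ne\alpha(z)$; $x\models\psi\in S$ implies $\mathfrak{M},\alpha(x)\models\psi$; $Rxy\in S$ implies $(\alpha(x),\alpha(y))\in R^\mathfrak{M}$. -}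

module Defs where

open import Level using (0ℓ)
open import Data.Nat as ℕ using (ℕ; zero; suc; _<_)
open import Data.Fin using (Fin)
open import Data.Bool using (Bool; true; false)
open import Data.Maybe using (Maybe; just; nothing)
open import Data.List using (List; []; _∷_; _++_; map; mapMaybe; filter; deduplicate; length)
open import Data.List.Membership.Propositional using (_∈_; _∉_)
open import Data.List.Relation.Binary.Pointwise using (Pointwise)
open import Data.Product using (Σ; ∃; _×_; _,_)
open import Data.Sum using (_⊎_)
open import Data.Empty using (⊥)
open import Relation.Nullary using (¬_; Dec; yes; no; does)
open import Relation.Nullary.Decidable using (map′; _×-dec_)
open import Relation.Binary.Definitions using (DecidableEquality)
open import Relation.Binary.PropositionalEquality using (_≡_; _≢_; refl; cong)
open import Relation.Binary.Construct.Closure.ReflexiveTransitive using (Star)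
open import Function.Definitions using (Injective)

infixr 6 _∧_
infixr 5 _∨_
infix 4 _≟F_ _≟C_

data Fm : Set where
  var   : ℕ → Fm
  ¬v_   : ℕ → Fm
  _∧_   : Fm → Fm → Fm
  _∨_   : Fm → Fm → Fm
  ⟨_⟩≥_·_ : ℕ → ℕ → Fm → Fm
  ⟨_⟩≤_·_ : ℕ → ℕ → Fm → Fm

-- ∼ψ : the NNF of ¬ψ  (the contradiction p ∧ ¬p uses the atom 0)
∼_ : Fm → Fm
∼ var p = ¬v p
∼ (¬v p) = var p
∼ (a ∧ b) = (∼ a) ∨ (∼ b)
∼ (a ∨ b) = (∼ a) ∧ (∼ b)
∼ (⟨ R ⟩≥ zero · ψ) = var 0 ∧ ¬v 0
∼ (⟨ R ⟩≥ suc n · ψ) = ⟨ R ⟩≤ n · ψ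
∼ (⟨ R ⟩≤ n · ψ) = ⟨ R ⟩≥ suc n · ψ

_≟F_ : DecidableEquality Fm
var a0 ≟F var b0 = map′ (cong var) (λ { refl → refl }) (a0 ℕ.≟ b0)
(¬v a0) ≟F (¬v b0) = map′ (cong ¬v_) (λ { refl → refl }) (a0 ℕ.≟ b0)
(a0 ∧ a1) ≟F (b0 ∧ b1) = map′ (λ { (refl , refl) → refl }) (λ { refl → refl , refl }) ((a0 ≟F b0) ×-dec (a1 ≟F b1))
(a0 ∨ a1) ≟F (b0 ∨ b1) = map′ (λ { (refl , refl) → refl }) (λ { refl → refl , refl }) ((a0 ≟F b0) ×-dec (a1 ≟F b1))
(⟨ a0 ⟩≥ a1 · a2) ≟F (⟨ b0 ⟩≥ b1 · b2) = map′ (λ { (refl , refl , refl) → refl }) (λ { refl → refl , refl , refl }) ((a0 ℕ.≟ b0) ×-dec (a1 ℕ.≟ b1) ×-dec (a2 ≟F b2))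
(⟨ a0 ⟩≤ a1 · a2) ≟F (⟨ b0 ⟩≤ b1 · b2) = map′ (λ { (refl , refl , refl) → refl }) (λ { refl → refl , refl , refl }) ((a0 ℕ.≟ b0) ×-dec (a1 ℕ.≟ b1) ×-dec (a2 ≟F b2))
(var _) ≟F (¬v _) = no (λ ())
(var _) ≟F (_ ∧ _) = no (λ ())
(var _) ≟F (_ ∨ _) = no (λ ())
(var _) ≟F (⟨ _ ⟩≥ _ · _) = no (λ ())
(var _) ≟F (⟨ _ ⟩≤ _ · _) = no (λ ())
(¬v _) ≟F (var _) = no (λ ())
(¬v _) ≟F (_ ∧ _) = no (λ ())
(¬v _) ≟F (_ ∨ _) = no (λ ())
(¬v _) ≟F (⟨ _ ⟩≥ _ · _) = no (λ ())
(¬v _) ≟F (⟨ _ ⟩≤ _ · _) = no (λ ())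
(_ ∧ _) ≟F (var _) = no (λ ())
(_ ∧ _) ≟F (¬v _) = no (λ ())
(_ ∧ _) ≟F (_ ∨ _) = no (λ ())
(_ ∧ _) ≟F (⟨ _ ⟩≥ _ · _) = no (λ ())
(_ ∧ _) ≟F (⟨ _ ⟩≤ _ · _) = no (λ ())
(_ ∨ _) ≟F (var _) = no (λ ())
(_ ∨ _) ≟F (¬v _) = no (λ ())
(_ ∨ _) ≟F (_ ∧ _) = no (λ ())
(_ ∨ _) ≟F (⟨ _ ⟩≥ _ · _) = no (λ ())
(_ ∨ _) ≟F (⟨ _ ⟩≤ _ · _) = no (λ ())
(⟨ _ ⟩≥ _ · _) ≟F (var _) = no (λ ())
(⟨ _ ⟩≥ _ · _) ≟F (¬v _) = no (λ ())
(⟨ _ ⟩≥ _ · _) ≟F (_ ∧ _) = no (λ ())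
(⟨ _ ⟩≥ _ · _) ≟F (_ ∨ _) = no (λ ())
(⟨ _ ⟩≥ _ · _) ≟F (⟨ _ ⟩≤ _ · _) = no (λ ())
(⟨ _ ⟩≤ _ · _) ≟F (var _) = no (λ ())
(⟨ _ ⟩≤ _ · _) ≟F (¬v _) = no (λ ())
(⟨ _ ⟩≤ _ · _) ≟F (_ ∧ _) = no (λ ())
(⟨ _ ⟩≤ _ · _) ≟F (_ ∨ _) = no (λ ())
(⟨ _ ⟩≤ _ · _) ≟F (⟨ _ ⟩≥ _ · _) = no (λ ())

record Kripke : Set₁ where
  field
    W   : Set
    Rel : ℕ → W → W → Set
    V   : ℕ → W → Set
open Kripke public

_,_⊩_ : (M : Kripke) → W M → Fm → Set
M , w ⊩ var p = V M p w
M , w ⊩ (¬v p) = ¬ V M p w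
M , w ⊩ (a ∧ b) = (M , w ⊩ a) × (M , w ⊩ b)
M , w ⊩ (a ∨ b) = (M , w ⊩ a) ⊎ (M , w ⊩ b)
M , w ⊩ (⟨ R ⟩≥ n · ψ) =
  Σ (Fin n → W M) λ f → Injective _≡_ _≡_ f × (∀ i → Rel M R w (f i) × (M , f i ⊩ ψ))
M , w ⊩ (⟨ R ⟩≤ n · ψ) =
  ¬ (Σ (Fin (suc n) → W M) λ f → Injective _≡_ _≡_ f × (∀ i → Rel M R w (f i) × (M , f i ⊩ ψ)))

data Con : Set where
  _⊨_  : ℕ → Fm → Con
  rel : ℕ → ℕ → ℕ → Con

_≟C_ : DecidableEquality Con
(x ⊨ a) ≟C (y ⊨ b) = map′ (λ { (refl , refl) → refl }) (λ { refl → refl , refl }) ((x ℕ.≟ y) ×-dec (a ≟F b))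
rel R x y ≟C rel R' x' y' =
  map′ (λ { (refl , refl , refl) → refl }) (λ { refl → refl , refl , refl })
       ((R ℕ.≟ R') ×-dec (x ℕ.≟ x') ×-dec (y ℕ.≟ y'))
(_ ⊨ _) ≟C rel _ _ _ = no (λ ())
rel _ _ _ ≟C (_ ⊨ _) = no (λ ())

-- A constraint system is a finite set of constraints, represented by a
-- list (read up to membership).
CS : Set
CS = List Con

_∈?_ : (c : Con) (S : CS) → Dec (c ∈ S)
c ∈? S = Data.List.Membership.DecPropositional._∈?_ _≟C_ c S
  where import Data.List.Membership.DecPropositional

succOf : ℕ → ℕ → Con → Maybe ℕ
succOf R x (rel R' x' y) with does (R ℕ.≟ R') | does (x ℕ.≟ x')
... | true | true = just y
... | _    | _    = nothing
succOf R x (_ ⊨ _) = nothing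

♯ : ℕ → CS → ℕ → Fm → ℕ
♯ R S x ψ = length (filter (λ y → (y ⊨ ψ) ∈? S) (deduplicate ℕ._≟_ (mapMaybe (succOf R x) S)))

gradedArg : ℕ → ℕ → Con → Maybe Fm
gradedArg R x (x' ⊨ (⟨ R' ⟩≥ m · ψ)) with does (R ℕ.≟ R') | does (x ℕ.≟ x')
... | true | true = just ψ
... | _    | _    = nothing
gradedArg R x (x' ⊨ (⟨ R' ⟩≤ m · ψ)) with does (R ℕ.≟ R') | does (x ℕ.≟ x')
... | true | true = just ψ
... | _    | _    = nothing
gradedArg R x _ = nothing

gradedArgs : CS → ℕ → ℕ → List Fm
gradedArgs S x R = deduplicate _≟F_ (mapMaybe (gradedArg R x) S)

OccursC : ℕ → Con → Set
OccursC y (x ⊨ _) = y ≡ x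
OccursC y (rel _ x z) = (y ≡ x) ⊎ (y ≡ z)

Fresh : ℕ → CS → Set
Fresh y S = ∀ c → c ∈ S → ¬ OccursC y c

data AndRule (S : CS) (x : ℕ) (a b : Fm) : CS → Set where
  and-rule : (x ⊨ (a ∧ b)) ∈ S → ¬ ((x ⊨ a) ∈ S × (x ⊨ b) ∈ S) →
             AndRule S x a b ((x ⊨ a) ∷ (x ⊨ b) ∷ S)

data OrRule (S : CS) (x : ℕ) (a b : Fm) : CS → Set where
  or-rule : (x ⊨ (a ∨ b)) ∈ S → (x ⊨ a) ∉ S → (x ⊨ b) ∉ S →
            (χ : Fm) → (χ ≡ a ⊎ χ ≡ b) →
            OrRule S x a b ((x ⊨ χ) ∷ S)

Saturated : CS → ℕ → Set
Saturated S x =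
  (∀ a b → (x ⊨ (a ∧ b)) ∈ S → ((x ⊨ a) ∈ S × (x ⊨ b) ∈ S)) ×
  (∀ a b → (x ⊨ (a ∨ b)) ∈ S → ((x ⊨ a) ∈ S ⊎ (x ⊨ b) ∈ S))

data GeRule (S : CS) (x R n : ℕ) (ψ : Fm) (y : ℕ) : CS → Set where
  ge-rule : (x ⊨ (⟨ R ⟩≥ n · ψ)) ∈ S → ♯ R S x ψ < n → Saturated S x → Fresh y S →
            (χs : List Fm) →
            Pointwise (λ ψᵢ χᵢ → χᵢ ≡ ψᵢ ⊎ χᵢ ≡ ∼ ψᵢ) (gradedArgs S x R) χs →
            GeRule S x R n ψ y (rel R x y ∷ (y ⊨ ψ) ∷ (map (y ⊨_) χs ++ S))

data Step (S S' : CS) : Set where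
  ∧-step : ∀ {x a b} → AndRule S x a b S' → Step S S'
  ∨-step : ∀ {x a b} → OrRule S x a b S' → Step S S'
  ≥-step : ∀ {x R n ψ y} → GeRule S x R n ψ y S' → Step S S'

Generated : ℕ → Fm → CS → Set
Generated x₀ φ S = Star Step ((x₀ ⊨ φ) ∷ []) S

Satisfiable : CS → Set₁
Satisfiable S = Σ Kripke λ M → Σ (ℕ → W M) λ α →
  (∀ R x y z → rel R x y ∈ S → rel R x z ∈ S → y ≢ z → α y ≢ α z) ×
  (∀ x ψ → (x ⊨ ψ) ∈ S → M , α x ⊩ ψ) ×
  (∀ R x y → rel R x y ∈ S → Rel M R (α x) (α y))

{-# OPTIONS --safe #-}
-- Every rule only adds constraints, so a model of S' is one of S.  Conversely
-- a model of S is a model of the result of the ∧-rule, and of the result of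
-- the ∨-rule that picks a disjunct it satisfies.  The substance is the
-- ≥-rule.  Along every run from {x₀ ⊨ φ}, whenever R x z ∈ S the variable x
-- is saturated and z carries ψ or ∼ψ for every ⟨R⟩≥ ψ at x: the ≥-rule only
-- fires at saturated x, and afterwards the ∧- and ∨-rules add nothing at x.
-- In a model of S the constraint x ⊨ ⟨R⟩≥n ψ yields n distinct R-successors
-- satisfying ψ; since fewer than n successors z with z ⊨ ψ are recorded, one
-- of them, w, is not the image of any of these, nor of any other successor z,
-- which satisfies ∼ψ.  Sending the fresh y to w and choosing each χᵢ to be
-- whichever of ψᵢ, ∼ψᵢ holds at w (excluded middle) gives a model of S'.
module Submission where

open import Defs
open import Level using (0ℓ)
open import Axiom.ExcludedMiddle using (ExcludedMiddle)
open import Data.Nat as ℕ using (ℕ; zero; suc; _<_)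
open import Data.Nat.Properties using (<⇒≱)
open import Data.Fin using (Fin)
open import Data.Fin.Properties using (injective⇒≤; ¬∀⟶∃¬)
open import Data.Maybe using (Maybe; just)
import Data.Maybe.Relation.Unary.Any as Maybe
open import Data.List as List using (List; []; _∷_; _++_; map; mapMaybe; filter; deduplicate; length)
open import Data.List.Properties using (length-map)
open import Data.List.Relation.Unary.Any as Any using (here; there; index)
open import Data.List.Relation.Unary.Any.Properties using (mapMaybe⁺; lookup-index)
open import Data.List.Relation.Unary.All as All using (All; []; _∷_)
open import Data.List.Relation.Binary.Pointwise using (Pointwise; []; _∷_)
open import Data.List.Relation.Binary.Subset.Propositional using (_⊆_)
open import Data.List.Relation.Binary.Subset.Propositional.Properties using (xs⊆x∷xs; xs⊆ys++xs)
open import Data.List.Membership.Propositional using (_∈_; _∉_)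
open import Data.List.Membership.Propositional.Properties
  using (∈-map⁺; ∈-map⁻; ∈-++⁺ˡ; ∈-++⁻; ∈-filter⁺; ∈-deduplicate⁺)
open import Data.Product using (Σ; ∃; _×_; _,_; proj₁; proj₂; map₁; map₂)
open import Data.Sum using (_⊎_; inj₁; inj₂; [_,_]′)
open import Function using (_∘_; id)
open import Function.Bundles using (_⇔_; mk⇔)
open import Function.Definitions using (Injective)
open import Relation.Nullary using (¬_; yes; no; contradiction)
open import Relation.Nullary.Decidable using (dec-true)
open import Relation.Binary.PropositionalEquality
  using (_≡_; _≢_; refl; sym; trans; cong; subst; subst₂; ≢-sym)
open import Relation.Binary.Construct.Closure.ReflexiveTransitive using (Star; ε; _◅_)

∈-mapMaybe⁺ : ∀ {A B : Set} (f : A → Maybe B) {xs a b} → a ∈ xs → f a ≡ just b → b ∈ mapMaybe f xs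
∈-mapMaybe⁺ f {xs} {a} {b} a∈xs fa≡b = mapMaybe⁺ f xs (Any.map just-b (∈-map⁺ f a∈xs))
  where
    just-b : ∀ {m} → f a ≡ m → Maybe.Any (b ≡_) m
    just-b refl = subst (Maybe.Any (b ≡_)) (sym fa≡b) (Maybe.just refl)

Pointwise-∈ : ∀ {A B : Set} {R : A → B → Set} {xs ys a} →
              Pointwise R xs ys → a ∈ xs → ∃ λ b → b ∈ ys × R a b
Pointwise-∈ (r ∷ _)  (here refl) = _ , here refl , r
Pointwise-∈ (_ ∷ rs) (there a∈xs) = map₂ (map₁ there) (Pointwise-∈ rs a∈xs)

injection-escapes : ExcludedMiddle 0ℓ → ∀ {A : Set} {n} (f : Fin n → A) → Injective _≡_ _≡_ f →
                    (xs : List A) → length xs < n → ∃ λ i → f i ∉ xs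
injection-escapes em {n = n} f f-inj xs |xs|<n = ¬∀⟶∃¬ n (λ i → f i ∈ xs) (λ _ → em) f⊈xs
  where
    f⊈xs : ¬ (∀ i → f i ∈ xs)
    f⊈xs f⊆xs = <⇒≱ |xs|<n (injective⇒≤ index-injective)
      where
        index-injective : Injective _≡_ _≡_ (λ i → index (f⊆xs i))
        index-injective {i} {j} eq = f-inj (trans (lookup-index (f⊆xs i))
          (trans (cong (List.lookup xs) eq) (sym (lookup-index (f⊆xs j)))))

_[_↦_] : ∀ {A : Set} → (ℕ → A) → ℕ → A → ℕ → A
(α [ y ↦ w ]) v with v ℕ.≟ y
... | yes _ = w
... | no _  = α v

module _ {A : Set} (α : ℕ → A) {w : A} where

  update-≡ : ∀ y → (α [ y ↦ w ]) y ≡ w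
  update-≡ y with y ℕ.≟ y
  ... | yes _   = refl
  ... | no y≢y = contradiction refl y≢y

  update-≢ : ∀ {v y} → v ≢ y → (α [ y ↦ w ]) v ≡ α v
  update-≢ {v} {y} v≢y with v ℕ.≟ y
  ... | yes v≡y = contradiction v≡y v≢y
  ... | no _    = refl

⊩∼⇒¬⊩ : ∀ {M w} ψ → M , w ⊩ (∼ ψ) → ¬ (M , w ⊩ ψ)
⊩∼⇒¬⊩ (var p)              ⊩∼ψ ⊩ψ = ⊩∼ψ ⊩ψ
⊩∼⇒¬⊩ (¬v p)               ⊩∼ψ ⊩ψ = ⊩ψ ⊩∼ψ
⊩∼⇒¬⊩ (a ∧ b)              (inj₁ ⊩∼a) (⊩a , _) = ⊩∼⇒¬⊩ a ⊩∼a ⊩a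
⊩∼⇒¬⊩ (a ∧ b)              (inj₂ ⊩∼b) (_ , ⊩b) = ⊩∼⇒¬⊩ b ⊩∼b ⊩b
⊩∼⇒¬⊩ (a ∨ b)              (⊩∼a , _) (inj₁ ⊩a) = ⊩∼⇒¬⊩ a ⊩∼a ⊩a
⊩∼⇒¬⊩ (a ∨ b)              (_ , ⊩∼b) (inj₂ ⊩b) = ⊩∼⇒¬⊩ b ⊩∼b ⊩b
⊩∼⇒¬⊩ (⟨ R ⟩≥ zero · ψ)    (p , ¬p) _ = ¬p p
⊩∼⇒¬⊩ (⟨ R ⟩≥ suc n · ψ)   ⊩∼ψ ⊩ψ = ⊩∼ψ ⊩ψ
⊩∼⇒¬⊩ (⟨ R ⟩≤ n · ψ)       ⊩∼ψ ⊩ψ = ⊩ψ ⊩∼ψ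

ChoiceOf : Fm → Fm → Set
ChoiceOf ψ χ = χ ≡ ψ ⊎ χ ≡ ∼ ψ

Models : (M : Kripke) → (ℕ → W M) → CS → Set
Models M α S =
  (∀ R x y z → rel R x y ∈ S → rel R x z ∈ S → y ≢ z → α y ≢ α z) ×
  (∀ x ψ → (x ⊨ ψ) ∈ S → M , α x ⊩ ψ) ×
  (∀ R x y → rel R x y ∈ S → Rel M R (α x) (α y))

Models-antitone : ∀ {M α S S'} → S ⊆ S' → Models M α S' → Models M α S
Models-antitone S⊆S' (distinct , labels , edges) =
  (λ R x y z e e' → distinct R x y z (S⊆S' e) (S⊆S' e')) ,
  (λ x ψ l → labels x ψ (S⊆S' l)) ,
  (λ R x y e → edges R x y (S⊆S' e))

Satisfiable-antitone : ∀ {S S'} → S ⊆ S' → Satisfiable S' → Satisfiable S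
Satisfiable-antitone S⊆S' (M , α , model) = M , α , Models-antitone S⊆S' model

Models-fresh-update : ∀ {M α S y w} → Fresh y S → Models M α S → Models M (α [ y ↦ w ]) S
Models-fresh-update {M} {α} {S} {y} fresh (distinct , labels , edges) =
  (λ R x u v e e' u≢v → subst₂ _≢_ (sym (update-≢ α (target≢y e))) (sym (update-≢ α (target≢y e')))
                                   (distinct R x u v e e' u≢v)) ,
  (λ x ψ l → subst (M ,_⊩ ψ) (sym (update-≢ α (≢-sym (fresh _ l)))) (labels x ψ l)) ,
  (λ R x u e → subst₂ (Rel M R) (sym (update-≢ α (source≢y e))) (sym (update-≢ α (target≢y e)))
                                (edges R x u e))
  where
    source≢y : ∀ {R x u} → rel R x u ∈ S → x ≢ y
    source≢y e = ≢-sym (fresh _ e ∘ inj₁)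
    target≢y : ∀ {R x u} → rel R x u ∈ S → u ≢ y
    target≢y e = ≢-sym (fresh _ e ∘ inj₂)

infix 6 _⊨*_

_⊨*_ : ℕ → List Fm → CS
y ⊨* φs = map (y ⊨_) φs

module _ {y : ℕ} {φs : List Fm} {S : CS} where

  rel-∈-⊨*-++⁻ : ∀ {R x z} → rel R x z ∈ y ⊨* φs ++ S → rel R x z ∈ S
  rel-∈-⊨*-++⁻ e with ∈-++⁻ (y ⊨* φs) e
  ... | inj₂ e∈S = e∈S
  ... | inj₁ e∈y⊨*φs with ∈-map⁻ (y ⊨_) e∈y⊨*φs
  ...   | _ , _ , ()

  ⊨-∈-⊨*-++⁻ : ∀ {v φ} → (v ⊨ φ) ∈ y ⊨* φs ++ S → (v ≡ y × φ ∈ φs) ⊎ (v ⊨ φ) ∈ S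
  ⊨-∈-⊨*-++⁻ l with ∈-++⁻ (y ⊨* φs) l
  ... | inj₂ l∈S = inj₂ l∈S
  ... | inj₁ l∈y⊨*φs with ∈-map⁻ (y ⊨_) l∈y⊨*φs
  ...   | _ , φ∈φs , refl = inj₁ (refl , φ∈φs)

  ⊨-∈-⊨*-++-other : ∀ {v φ} → v ≢ y → (v ⊨ φ) ∈ y ⊨* φs ++ S → (v ⊨ φ) ∈ S
  ⊨-∈-⊨*-++-other v≢y = [ (λ (v≡y , _) → contradiction v≡y v≢y) , id ]′ ∘ ⊨-∈-⊨*-++⁻

  Models-⊨*-++ : ∀ {M α} → Models M α S → All (M , α y ⊩_) φs → Models M α (y ⊨* φs ++ S)
  Models-⊨*-++ {M} {α} (distinct , labels , edges) ⊩φs =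
    (λ R x u v e e' → distinct R x u v (rel-∈-⊨*-++⁻ e) (rel-∈-⊨*-++⁻ e')) ,
    labels' ,
    (λ R x u e → edges R x u (rel-∈-⊨*-++⁻ e))
    where
      labels' : ∀ x ψ → (x ⊨ ψ) ∈ y ⊨* φs ++ S → M , α x ⊩ ψ
      labels' x ψ l with ⊨-∈-⊨*-++⁻ l
      ... | inj₁ (refl , ψ∈φs) = All.lookup ⊩φs ψ∈φs
      ... | inj₂ l∈S           = labels x ψ l∈S

Models-∷-rel : ∀ {M α S R x y} → Models M α S → Rel M R (α x) (α y) →
               (∀ z → rel R x z ∈ S → y ≢ z → α y ≢ α z) → Models M α (rel R x y ∷ S)
Models-∷-rel {M} {α} {S} {R} {x} {y} (distinct , labels , edges) edge apart =
  distinct' , (λ { _ _ (here ()) ; u ψ (there l) → labels u ψ l }) , edges'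
  where
    distinct' : ∀ R' x' u v → rel R' x' u ∈ rel R x y ∷ S → rel R' x' v ∈ rel R x y ∷ S →
                u ≢ v → α u ≢ α v
    distinct' _ _ _ _ (here refl) (here refl) u≢v = contradiction refl u≢v
    distinct' _ _ _ v (here refl) (there e')  u≢v = apart v e' u≢v
    distinct' _ _ u _ (there e)  (here refl)  u≢v = ≢-sym (apart u e (≢-sym u≢v))
    distinct' R' x' u v (there e) (there e')  u≢v = distinct R' x' u v e e' u≢v
    edges' : ∀ R' x' u → rel R' x' u ∈ rel R x y ∷ S → Rel M R' (α x') (α u)
    edges' _ _ _ (here refl) = edge
    edges' R' x' u (there e) = edges R' x' u e

AndRule-⊆ : ∀ {S x a b S'} → AndRule S x a b S' → S ⊆ S'
AndRule-⊆ {S} {x} {a} {b} (and-rule _ _) = xs⊆ys++xs S (x ⊨* (a ∷ b ∷ []))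

OrRule-⊆ : ∀ {S x a b S'} → OrRule S x a b S' → S ⊆ S'
OrRule-⊆ {S} (or-rule _ _ _ _ _) = xs⊆x∷xs S _

GeRule-⊆ : ∀ {S x R n ψ y S'} → GeRule S x R n ψ y S' → S ⊆ S'
GeRule-⊆ {S} {ψ = ψ} {y} (ge-rule _ _ _ _ χs _) = xs⊆x∷xs _ _ ∘ xs⊆ys++xs S (y ⊨* (ψ ∷ χs))

Decides : CS → ℕ → ℕ → ℕ → Set
Decides S R x z = ∀ m ψ → (x ⊨ (⟨ R ⟩≥ m · ψ)) ∈ S → (z ⊨ ψ) ∈ S ⊎ (z ⊨ (∼ ψ)) ∈ S

EdgeInvariant : CS → Set
EdgeInvariant S = ∀ R x z → rel R x z ∈ S → Saturated S x × Decides S R x z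

module _ {S S' : CS} {x : ℕ} (S⊆S' : S ⊆ S')
         (no-new-labels : ∀ {φ} → (x ⊨ φ) ∈ S' → (x ⊨ φ) ∈ S) where

  Saturated-mono : Saturated S x → Saturated S' x
  Saturated-mono (and-closed , or-closed) =
    (λ a b l → Data.Product.map S⊆S' S⊆S' (and-closed a b (no-new-labels l))) ,
    (λ a b l → Data.Sum.map S⊆S' S⊆S' (or-closed a b (no-new-labels l)))

  Decides-mono : ∀ {R z} → Decides S R x z → Decides S' R x z
  Decides-mono decides m ψ l = Data.Sum.map S⊆S' S⊆S' (decides m ψ (no-new-labels l))

EdgeInvariant-⊨*-++ : ∀ {S x φs} → EdgeInvariant S → ¬ Saturated S x → EdgeInvariant (x ⊨* φs ++ S)
EdgeInvariant-⊨*-++ {S} {x} {φs} invariant unsaturated R v z e =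
  Saturated-mono S⊆S' no-new-labels saturated , Decides-mono S⊆S' no-new-labels decides
  where
    saturated : Saturated S v
    saturated = proj₁ (invariant R v z (rel-∈-⊨*-++⁻ e))
    decides : Decides S R v z
    decides = proj₂ (invariant R v z (rel-∈-⊨*-++⁻ e))
    S⊆S' : S ⊆ x ⊨* φs ++ S
    S⊆S' = xs⊆ys++xs S (x ⊨* φs)
    no-new-labels : ∀ {φ} → (v ⊨ φ) ∈ x ⊨* φs ++ S → (v ⊨ φ) ∈ S
    no-new-labels = ⊨-∈-⊨*-++-other λ { refl → unsaturated saturated }

gradedArg-≥ : ∀ R x m ψ → gradedArg R x (x ⊨ (⟨ R ⟩≥ m · ψ)) ≡ just ψ
gradedArg-≥ R x m ψ rewrite dec-true (R ℕ.≟ R) refl | dec-true (x ℕ.≟ x) refl = refl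

∈-gradedArgs : ∀ {S x R m ψ} → (x ⊨ (⟨ R ⟩≥ m · ψ)) ∈ S → ψ ∈ gradedArgs S x R
∈-gradedArgs {S} {x} {R} {m} {ψ} l =
  ∈-deduplicate⁺ _≟F_ (∈-mapMaybe⁺ (gradedArg R x) l (gradedArg-≥ R x m ψ))

EdgeInvariant-GeRule : ∀ {S x R n ψ y S'} → EdgeInvariant S → GeRule S x R n ψ y S' → EdgeInvariant S'
EdgeInvariant-GeRule {S} {x} {R} {ψ = ψ} {y} invariant (ge-rule l _ saturated fresh χs choices) = invariant'
  where
    S' : CS
    S' = rel R x y ∷ y ⊨* (ψ ∷ χs) ++ S
    S⊆S' : S ⊆ S'
    S⊆S' = xs⊆x∷xs _ _ ∘ xs⊆ys++xs S (y ⊨* (ψ ∷ χs))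
    x≢y : x ≢ y
    x≢y = ≢-sym (fresh _ l)

    no-new-labels : ∀ {v φ} → v ≢ y → (v ⊨ φ) ∈ S' → (v ⊨ φ) ∈ S
    no-new-labels v≢y (there l') = ⊨-∈-⊨*-++-other v≢y l'

    y-decides : Decides S' R x y
    y-decides m ψ' l' with Pointwise-∈ choices (∈-gradedArgs (no-new-labels x≢y l'))
    ... | χ , χ∈χs , inj₁ refl = inj₁ (there (there (∈-++⁺ˡ (∈-map⁺ (y ⊨_) χ∈χs))))
    ... | χ , χ∈χs , inj₂ refl = inj₂ (there (there (∈-++⁺ˡ (∈-map⁺ (y ⊨_) χ∈χs))))

    invariant' : EdgeInvariant S'
    invariant' _ _ _ (here refl) =
      Saturated-mono S⊆S' (no-new-labels x≢y) saturated , y-decides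
    invariant' R' v z (there e) =
      Data.Product.map (Saturated-mono S⊆S' (no-new-labels v≢y)) (Decides-mono S⊆S' (no-new-labels v≢y))
                       (invariant R' v z e∈S)
      where
        e∈S : rel R' v z ∈ S
        e∈S = rel-∈-⊨*-++⁻ e
        v≢y : v ≢ y
        v≢y = ≢-sym (fresh _ e∈S ∘ inj₁)

EdgeInvariant-Step : ∀ {S S'} → EdgeInvariant S → Step S S' → EdgeInvariant S'
EdgeInvariant-Step invariant (∧-step {a = a} {b} (and-rule l both∉)) =
  EdgeInvariant-⊨*-++ invariant (λ (and-closed , _) → both∉ (and-closed a b l))
EdgeInvariant-Step invariant (∨-step {a = a} {b} (or-rule l a∉ b∉ _ _)) =
  EdgeInvariant-⊨*-++ invariant (λ (_ , or-closed) → [ a∉ , b∉ ]′ (or-closed a b l))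
EdgeInvariant-Step invariant (≥-step rule) = EdgeInvariant-GeRule invariant rule

EdgeInvariant-generated : ∀ {x₀ φ S} → Generated x₀ φ S → EdgeInvariant S
EdgeInvariant-generated = go (λ { _ _ _ (here ()) ; _ _ _ (there ()) })
  where
    go : ∀ {S S'} → EdgeInvariant S → Star Step S S' → EdgeInvariant S'
    go invariant ε          = invariant
    go invariant (step ◅ steps) = go (EdgeInvariant-Step invariant step) steps

countedSuccessors : ℕ → CS → ℕ → Fm → List ℕ
countedSuccessors R S x ψ = filter (λ y → (y ⊨ ψ) ∈? S) (deduplicate ℕ._≟_ (mapMaybe (succOf R x) S))

succOf-rel : ∀ R x z → succOf R x (rel R x z) ≡ just z
succOf-rel R x z rewrite dec-true (R ℕ.≟ R) refl | dec-true (x ℕ.≟ x) refl = refl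

∈-countedSuccessors : ∀ {R S x z ψ} → rel R x z ∈ S → (z ⊨ ψ) ∈ S →
                      z ∈ countedSuccessors R S x ψ
∈-countedSuccessors {R} {S} {x} {z} {ψ} e =
  ∈-filter⁺ (λ y → (y ⊨ ψ) ∈? S)
            (∈-deduplicate⁺ ℕ._≟_ (∈-mapMaybe⁺ (succOf R x) e (succOf-rel R x z)))

module _ (em : ExcludedMiddle 0ℓ) where

  ¬⊩⇒⊩∼ : ∀ {M w} ψ → ¬ (M , w ⊩ ψ) → M , w ⊩ (∼ ψ)
  ¬⊩⇒⊩∼ (var p)              ⊮ψ = ⊮ψ
  ¬⊩⇒⊩∼ {M} {w} (¬v p)       ⊮ψ with em {V M p w}
  ... | yes ⊩p = ⊩p
  ... | no ⊮p  = contradiction ⊮p ⊮ψ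
  ¬⊩⇒⊩∼ {M} {w} (a ∧ b)      ⊮ψ with em {M , w ⊩ a}
  ... | yes ⊩a = inj₂ (¬⊩⇒⊩∼ b (λ ⊩b → ⊮ψ (⊩a , ⊩b)))
  ... | no ⊮a  = inj₁ (¬⊩⇒⊩∼ a ⊮a)
  ¬⊩⇒⊩∼ (a ∨ b)              ⊮ψ = ¬⊩⇒⊩∼ a (⊮ψ ∘ inj₁) , ¬⊩⇒⊩∼ b (⊮ψ ∘ inj₂)
  ¬⊩⇒⊩∼ (⟨ R ⟩≥ zero · ψ)    ⊮ψ = contradiction ((λ ()) , (λ { {()} }) , (λ ())) ⊮ψ
  ¬⊩⇒⊩∼ (⟨ R ⟩≥ suc n · ψ)   ⊮ψ = ⊮ψ
  ¬⊩⇒⊩∼ {M} {w} (⟨ R ⟩≤ n · ψ) ⊮ψ with em {M , w ⊩ (⟨ R ⟩≥ suc n · ψ)}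
  ... | yes ⊩∼ψ = ⊩∼ψ
  ... | no ⊮∼ψ  = contradiction ⊮∼ψ ⊮ψ

  choices-true-at : ∀ M w (ψs : List Fm) → ∃ λ χs → Pointwise ChoiceOf ψs χs × All (M , w ⊩_) χs
  choices-true-at M w [] = [] , [] , []
  choices-true-at M w (ψ ∷ ψs) with choices-true-at M w ψs | em {M , w ⊩ ψ}
  ... | χs , choices , ⊩χs | yes ⊩ψ = ψ ∷ χs , inj₁ refl ∷ choices , ⊩ψ ∷ ⊩χs
  ... | χs , choices , ⊩χs | no ⊮ψ  = ∼ ψ ∷ χs , inj₂ refl ∷ choices , ¬⊩⇒⊩∼ ψ ⊮ψ ∷ ⊩χs

  fresh-successor : ∀ {M α S x R n ψ} → Models M α S → EdgeInvariant S →
                    (x ⊨ (⟨ R ⟩≥ n · ψ)) ∈ S → ♯ R S x ψ < n →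
                    ∃ λ w → Rel M R (α x) w × M , w ⊩ ψ × (∀ z → rel R x z ∈ S → w ≢ α z)
  fresh-successor {M} {α} {S} {x} {R} {n} {ψ} (_ , labels , _) invariant l ♯<n
    with labels x _ l
  ... | g , g-injective , g-successors
    with injection-escapes em g g-injective (map α (countedSuccessors R S x ψ))
           (subst (_< n) (sym (length-map α (countedSuccessors R S x ψ))) ♯<n)
  ... | i , gi∉counted = g i , proj₁ (g-successors i) , proj₂ (g-successors i) , apart
    where
      apart : ∀ z → rel R x z ∈ S → g i ≢ α z
      apart z e gi≡αz with proj₂ (invariant R x z e) n ψ l
      ... | inj₁ z⊨ψ  =
        gi∉counted (subst (_∈ _) (sym gi≡αz) (∈-map⁺ α (∈-countedSuccessors e z⊨ψ)))
      ... | inj₂ z⊨∼ψ =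
        ⊩∼⇒¬⊩ ψ (labels z _ z⊨∼ψ) (subst (M ,_⊩ ψ) gi≡αz (proj₂ (g-successors i)))

  GeRule-complete : ∀ {S x R n ψ y S'} → EdgeInvariant S → Satisfiable S → GeRule S x R n ψ y S' →
                    Σ CS λ S'' → GeRule S x R n ψ y S'' × Satisfiable S''
  GeRule-complete {S} {x} {R} {ψ = ψ} {y} invariant (M , α , model) (ge-rule l ♯<n saturated fresh _ _)
    with fresh-successor model invariant l ♯<n
  ... | w , edge , ⊩ψ , apart
    with choices-true-at M w (gradedArgs S x R)
  ... | χs , choices , ⊩χs =
    _ , ge-rule l ♯<n saturated fresh χs choices , M , α' , model'
    where
      α' : ℕ → W M
      α' = α [ y ↦ w ]
      x≢y : x ≢ y
      x≢y = ≢-sym (fresh _ l)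
      apart' : ∀ z → rel R x z ∈ y ⊨* (ψ ∷ χs) ++ S → y ≢ z → α' y ≢ α' z
      apart' z e _ = subst₂ _≢_ (sym (update-≡ α y)) (sym (update-≢ α z≢y)) (apart z e∈S)
        where
          e∈S : rel R x z ∈ S
          e∈S = rel-∈-⊨*-++⁻ e
          z≢y : z ≢ y
          z≢y = ≢-sym (fresh _ e∈S ∘ inj₂)
      model' : Models M α' (rel R x y ∷ y ⊨* (ψ ∷ χs) ++ S)
      model' = Models-∷-rel
        (Models-⊨*-++ (Models-fresh-update fresh model)
                      (subst (λ u → All (M , u ⊩_) (ψ ∷ χs)) (sym (update-≡ α y)) (⊩ψ ∷ ⊩χs)))
        (subst₂ (Rel M R) (sym (update-≢ α x≢y)) (sym (update-≡ α y)) edge)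
        apart'

AndRule-satisfiable-⇔ : ∀ {S x a b S'} → AndRule S x a b S' → Satisfiable S ⇔ Satisfiable S'
AndRule-satisfiable-⇔ rule@(and-rule l _) = mk⇔ extend (Satisfiable-antitone (AndRule-⊆ rule))
  where
    extend : Satisfiable _ → Satisfiable _
    extend (M , α , model@(_ , labels , _)) =
      M , α , Models-⊨*-++ model (proj₁ (labels _ _ l) ∷ proj₂ (labels _ _ l) ∷ [])

OrRule-complete : ∀ {S x a b S'} → Satisfiable S → OrRule S x a b S' →
                  Σ CS λ S'' → OrRule S x a b S'' × Satisfiable S''
OrRule-complete {a = a} {b} (M , α , model@(_ , labels , _)) (or-rule l a∉ b∉ _ _) with labels _ _ l
... | inj₁ ⊩a = _ , or-rule l a∉ b∉ a (inj₁ refl) , M , α , Models-⊨*-++ model (⊩a ∷ [])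
... | inj₂ ⊩b = _ , or-rule l a∉ b∉ b (inj₂ refl) , M , α , Models-⊨*-++ model (⊩b ∷ [])

lemma2 : ExcludedMiddle 0ℓ → (x₀ : ℕ) (φ : Fm) (S : CS) → Generated x₀ φ S →
    -- (1) ∧-rule: S satisfiable iff S' satisfiable
    (∀ x a b S' → AndRule S x a b S' → (Satisfiable S ⇔ Satisfiable S')) ×
    -- (2) ∨-rule / ≥-rule: soundness
    (∀ x a b S' → OrRule S x a b S' → Satisfiable S' → Satisfiable S) ×
    (∀ x R n ψ y S' → GeRule S x R n ψ y S' → Satisfiable S' → Satisfiable S) ×
    -- (2) moreover: if S is satisfiable, every applicable instance of the rule
    -- can be carried out (by suitable choices) so that the result is satisfiable
    (Satisfiable S → ∀ x a b S' → OrRule S x a b S' →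
      Σ CS λ S'' → OrRule S x a b S'' × Satisfiable S'') ×
    (Satisfiable S → ∀ x R n ψ y S' → GeRule S x R n ψ y S' →
      Σ CS λ S'' → GeRule S x R n ψ y S'' × Satisfiable S'')
lemma2 em _ _ _ generated =
  (λ _ _ _ _ → AndRule-satisfiable-⇔) ,
  (λ _ _ _ _ rule → Satisfiable-antitone (OrRule-⊆ rule)) ,
  (λ _ _ _ _ _ _ rule → Satisfiable-antitone (GeRule-⊆ rule)) ,
  (λ sat _ _ _ _ → OrRule-complete sat) ,
  (λ sat _ _ _ _ _ _ → GeRule-complete em (EdgeInvariant-generated generated) sat)
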